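{- Let $R$ be a ring that is complete with respect to a valuation $v$, and let $M=(M_{jk})_{j,k\in\mathbb{Z}^+}$ be an infinite matrix with entries in $R$ such that $v(M_{jk})\ge|j-k|$ for all $j,k$ and every diagonal entry $M_{jj}$ is a unit of $R$. Then $M$ is invertible, $v(M^{ -1}_{jk})\ge|j-k|$ for all $j,k$, and for every $m\in\mathbb{Z}^+$ and $1\le j,k\le m$, \[ v\big((M(m)^{ -1}-M^{ -1}(m))_{jk}\big)\ge 2m+2-j-k,\qquad v\big((M(m)-M^{ -1}(m)^{ -1})_{jk}\big)\ge 2m+2-j-k. \] In particular, for fixed $j,k$, $\lim_{m\to\infty}M(m)^{ -1}_{jk}=M^{ -1}_{jk}$ and $\lim_{m\to\infty}M^{ -1}(m)^{ -1}_{jk}=M_{jk}$ (limits in the $v$-adic topology).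
   Context: A filtration on a ring $R$ is a sequence of ideals $R=I_0\supsetneq I_1\supsetneq I_2\supsetneq\cdots$ with $I_jI_k\subset I_{j+k}$ and $\bigcap_j I_j=\{0\}$; the associated valuation is $v(x)=$ the largest $j$ with $x\in I_j$ (for $x\ne 0$; $v(0)=\infty$), so $v(xy)\ge v(x)+v(y)$ and $v(x+y)\ge\min(v(x),v(y))$. $R$ is complete if every sequence $x_n$ with $\min_{j\ne k\ge n}v(x_j-x_k)\to\infty$ has a limit $x\in R$ with $v(x_n-x)\to\infty$ (e.g. formal power series rings graded by degree). For an infinite matrix $N$, $N(m)$ denotes its upper-left $m\times m$ principal submatrix; thus $M^{ -1}(m)$ is the upper-left $m\times m$ submatrix of $M^{ -1}$, and $M(m)^{ -1}$ is the inverse of $M(m)$. Products of infinite matrices are defined as convergent sums in the valuation topology. -}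

module Defs where

open import Level using (Level; _⊔_)
import Level as L
open import Algebra.Bundles using (Ring)
open import Data.Nat using (ℕ; zero; suc; _≤_; _<_; _≡ᵇ_) renaming (_+_ to _+ℕ_)
open import Data.Fin using (Fin; toℕ)
import Data.Fin as F
open import Data.Bool using (if_then_else_)
open import Data.Product using (Σ; _×_; _,_)
open import Relation.Nullary using (¬_)

module _ {c ℓ : Level} (R : Ring c ℓ) where
  open Ring R

  -- A filtration R = I 0 ⊋ I 1 ⊋ ... by two-sided ideals with I j · I k ⊆ I (j+k)
  -- and ⋂ I j = {0}.  "I j x" means v(x) ≥ j for the associated valuation v.
  record Filtration (ℓ' : Level) : Set (c ⊔ ℓ ⊔ L.suc ℓ') where
    field
      I        : ℕ → Carrier → Set ℓ'
      I-resp   : ∀ {j x y} → x ≈ y → I j x → I j y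
      I-top    : ∀ x → I 0 x
      I-zero   : ∀ j → I j 0#
      I-+      : ∀ {j x y} → I j x → I j y → I j (x + y)
      I-*ˡ     : ∀ {j} r {x} → I j x → I j (r * x)
      I-*ʳ     : ∀ {j x} r → I j x → I j (x * r)
      I-mono   : ∀ {j x} → I (suc j) x → I j x
      I-strict : ∀ j → Σ Carrier λ x → I j x × ¬ I (suc j) x
      I-mul    : ∀ {j k x y} → I j x → I k y → I (j +ℕ k) (x * y)
      I-sep    : ∀ {x} → (∀ j → I j x) → x ≈ 0#

  module _ {ℓ' : Level} (Fl : Filtration ℓ') where
    open Filtration Fl

    HasLimit : (ℕ → Carrier) → Carrier → Set ℓ'
    HasLimit s x = ∀ K → Σ ℕ λ n → ∀ p → n ≤ p → I K (s p - x)

    Cauchy : (ℕ → Carrier) → Set ℓ'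
    Cauchy s = ∀ K → Σ ℕ λ n → ∀ p q → n ≤ p → n ≤ q → I K (s p - s q)

    Complete : Set (c ⊔ ℓ')
    Complete = ∀ s → Cauchy s → Σ Carrier λ x → HasLimit s x

    psum : (ℕ → Carrier) → ℕ → Carrier
    psum a zero    = 0#
    psum a (suc n) = psum a n + a n

    SumsTo : (ℕ → Carrier) → Carrier → Set ℓ'
    SumsTo a x = HasLimit (psum a) x

    -- infinite matrices indexed by ℕ × ℕ  (index 0 corresponds to the paper's 1)
    Mat : Set c
    Mat = ℕ → ℕ → Carrier

    δ : Mat
    δ j k = if j ≡ᵇ k then 1# else 0#

    IsProduct : Mat → Mat → Mat → Set ℓ'
    IsProduct A B C = ∀ j k → SumsTo (λ l → A j l * B l k) (C j k)

    IsInverse : Mat → Mat → Set ℓ'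
    IsInverse M N = IsProduct M N δ × IsProduct N M δ

  IsUnit : Carrier → Set (c ⊔ ℓ)
  IsUnit x = Σ Carrier λ u → (u * x ≈ 1#) × (x * u ≈ 1#)

  FMat : ℕ → Set c
  FMat m = Fin m → Fin m → Carrier

  fsum : ∀ {m} → (Fin m → Carrier) → Carrier
  fsum {zero}  f = 0#
  fsum {suc m} f = f F.zero + fsum (λ i → f (F.suc i))

  fmul : ∀ {m} → FMat m → FMat m → FMat m
  fmul A B i k = fsum (λ l → A i l * B l k)

  fid : ∀ {m} → FMat m
  fid i k = if toℕ i ≡ᵇ toℕ k then 1# else 0#

  IsFInverse : ∀ {m} → FMat m → FMat m → Set ℓ
  IsFInverse A B = (∀ i k → fmul A B i k ≈ fid i k) × (∀ i k → fmul B A i k ≈ fid i k)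

  trunc : (ℕ → ℕ → Carrier) → (m : ℕ) → FMat m
  trunc N m i k = N (toℕ i) (toℕ k)

-- Eliminating the first row and column of a banded matrix X with unit diagonal leaves the Schur
-- complement S = D - col a⁻¹ row, which is again banded with unit diagonal (a unit plus an element
-- of I 1 is a unit, by the geometric series); inducting on the size gives every block M(m) a banded
-- inverse A m. Writing A (m + d) = A m (M A (m + d)) on the m × m block shows that A m and A (m + d)
-- agree there up to valuation 2m - j - k, so the entries of A m converge to a matrix N, which is
-- banded and a two-sided inverse of M. The same bound for M - N(m)⁻¹ comes from the identity
-- M - N(m)⁻¹ = M (N - A m) N(m)⁻¹ on the m × m block. (Indices start at 0, so the paper's
-- 2m + 2 - j - k reads 2m - j - k here.)

module Submission where

open import Defs
open import Level using (Level) renaming (_⊔_ to _⊔ˡ_)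
open import Algebra.Bundles using (Ring)
import Algebra.Properties.Ring as RingProperties
import Algebra.Properties.Semiring.Sum as SumProperties
import Algebra.Properties.Semiring.Exp as ExpProperties
import Algebra.Properties.CommutativeSemigroup as CommSemigroupProperties
import Relation.Binary.Reasoning.Setoid as SetoidReasoning
open import Data.Fin using (Fin; toℕ; fromℕ<)
import Data.Fin as Fin
open import Data.Fin.Properties using (toℕ<n; toℕ-fromℕ<)
open import Data.Nat
  using (ℕ; zero; suc; _≤_; _<_; _∸_; _⊔_; ∣_-_∣; z≤n; s≤s; _≤′_; ≤′-refl; ≤′-step)
  renaming (_+_ to _+ℕ_)
import Data.Nat.Properties as ℕₚ
open import Data.Product using (Σ; _×_; _,_; proj₁; proj₂)
open import Data.Sum using (inj₁; inj₂)
open import Relation.Binary.PropositionalEquality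
  using (_≡_; cong; cong₂; subst; subst₂) renaming (refl to ≡-refl; sym to ≡-sym; trans to ≡-trans)

-- Index arithmetic

∸-lipschitz : ∀ x a b → x ∸ a ≤ ∣ a - b ∣ +ℕ (x ∸ b)
∸-lipschitz x       zero    b       = ℕₚ.m≤n+m∸n x b
∸-lipschitz x       (suc a) zero    = ℕₚ.≤-trans (ℕₚ.m∸n≤m x (suc a)) (ℕₚ.m≤n+m x (suc a))
∸-lipschitz zero    (suc a) (suc b) = z≤n
∸-lipschitz (suc x) (suc a) (suc b) = ∸-lipschitz x a b

∸∸-lipschitzˡ : ∀ x j l k → x ∸ j ∸ k ≤ ∣ j - l ∣ +ℕ (x ∸ l ∸ k)
∸∸-lipschitzˡ x j l k =
  subst₂ _≤_ (≡-sym (ℕₚ.∸-+-assoc x j k))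
             (cong₂ _+ℕ_ shift (≡-sym (ℕₚ.∸-+-assoc x l k)))
             (∸-lipschitz x (j +ℕ k) (l +ℕ k))
  where
  shift : ∣ j +ℕ k - l +ℕ k ∣ ≡ ∣ j - l ∣
  shift = ≡-trans (cong₂ ∣_-_∣ (ℕₚ.+-comm j k) (ℕₚ.+-comm l k)) (ℕₚ.∣m+n-m+o∣≡∣n-o∣ k j l)

∸∸-lipschitzʳ : ∀ x j l k → x ∸ j ∸ k ≤ (x ∸ j ∸ l) +ℕ ∣ l - k ∣
∸∸-lipschitzʳ x j l k =
  subst (x ∸ j ∸ k ≤_)
        (≡-trans (cong (_+ℕ (x ∸ j ∸ l)) (ℕₚ.∣-∣-comm k l)) (ℕₚ.+-comm ∣ l - k ∣ (x ∸ j ∸ l)))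
        (∸-lipschitz (x ∸ j) k l)

m+m∸l∸k≤∣l-m+t∣+∣m+t-k∣ : ∀ m t l k → m +ℕ m ∸ l ∸ k ≤ ∣ l - m +ℕ t ∣ +ℕ ∣ m +ℕ t - k ∣
m+m∸l∸k≤∣l-m+t∣+∣m+t-k∣ m t l k =
  ℕₚ.≤-trans (∸∸-lipschitzˡ (m +ℕ m) l (m +ℕ t) k) (ℕₚ.+-monoʳ-≤ ∣ l - m +ℕ t ∣ tail)
  where
  tail : m +ℕ m ∸ (m +ℕ t) ∸ k ≤ ∣ m +ℕ t - k ∣
  tail = subst (λ z → z ∸ k ≤ ∣ m +ℕ t - k ∣) (≡-sym (ℕₚ.[m+n]∸[m+o]≡n∸o m m t))
           (ℕₚ.≤-trans (ℕₚ.∸-monoˡ-≤ k (ℕₚ.≤-trans (ℕₚ.m∸n≤m m t) (ℕₚ.m≤m+n m t)))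
                       (ℕₚ.m∸n≤∣m-n∣ (m +ℕ t) k))

∣-∣≤suc+suc : ∀ j k → ∣ j - k ∣ ≤ suc j +ℕ suc k
∣-∣≤suc+suc j k = ℕₚ.≤-trans (ℕₚ.∣m-n∣≤m⊔n j k)
                    (ℕₚ.≤-trans (ℕₚ.m⊔n≤m+n j k) (ℕₚ.+-mono-≤ (ℕₚ.n≤1+n j) (ℕₚ.n≤1+n k)))

-- Past this threshold the bound 2p - j - k of the entry (j, k) of a p × p block exceeds K.
threshold : ℕ → ℕ → ℕ → ℕ
threshold j k K = suc (j +ℕ k +ℕ K)

threshold-<ˡ : ∀ j k K {p} → threshold j k K ≤ p → j < p
threshold-<ˡ j k K h = ℕₚ.≤-trans (s≤s (ℕₚ.≤-trans (ℕₚ.m≤m+n j k) (ℕₚ.m≤m+n (j +ℕ k) K))) h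

threshold-<ʳ : ∀ j k K {p} → threshold j k K ≤ p → k < p
threshold-<ʳ j k K h = ℕₚ.≤-trans (s≤s (ℕₚ.≤-trans (ℕₚ.m≤n+m k j) (ℕₚ.m≤m+n (j +ℕ k) K))) h

threshold-bound : ∀ j k K {p} → threshold j k K ≤ p → K ≤ p +ℕ p ∸ j ∸ k
threshold-bound j k K {p} h =
  subst (K ≤_) (≡-sym (ℕₚ.∸-+-assoc (p +ℕ p) j k))
    (ℕₚ.m+n≤o⇒m≤o∸n K (subst (_≤ p +ℕ p) (ℕₚ.+-comm (j +ℕ k) K)
                              (ℕₚ.≤-trans (ℕₚ.<⇒≤ h) (ℕₚ.m≤m+n p p))))

∀Fin⇒∀< : ∀ {a m} (P : ℕ → ℕ → Set a) → (∀ (i k : Fin m) → P (toℕ i) (toℕ k)) →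
          ∀ {j k} → j < m → k < m → P j k
∀Fin⇒∀< P h j<m k<m = subst₂ P (toℕ-fromℕ< j<m) (toℕ-fromℕ< k<m) (h (fromℕ< j<m) (fromℕ< k<m))

module _ {c ℓ ℓ' : Level} (R : Ring c ℓ) (Fl : Filtration R ℓ') where
  open Ring R
  open RingProperties R
  open CommSemigroupProperties +-commutativeSemigroup using (xy∙z≈xz∙y)
  open SumProperties semiring
    using (sum; sum-cong-≋; sum-cong-≗; sum-replicate-zero; ∑-distrib-+; ∑-comm; *-distribˡ-sum; *-distribʳ-sum)
  open ExpProperties semiring using (_^_; ^-homo-*; ^-congʳ)
  open SetoidReasoning setoid
  open Filtration Fl

  x-y+y≈x : ∀ x y → (x - y) + y ≈ x
  x-y+y≈x x y = //-rightDividesˡ y x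

  x+y-y≈x : ∀ x y → (x + y) - y ≈ x
  x+y-y≈x x y = //-rightDividesʳ y x

  x-y+[y-z]≈x-z : ∀ x y z → (x - y) + (y - z) ≈ x - z
  x-y+[y-z]≈x-z x y z = begin
    (x - y) + (y - z)   ≈⟨ +-assoc x (- y) (y - z) ⟩
    x + (- y + (y - z)) ≈⟨ +-congˡ (\\-leftDividesʳ y (- z)) ⟩
    x - z               ∎

  x-[x-y]≈y : ∀ x y → x - (x - y) ≈ y
  x-[x-y]≈y x y = begin
    x - (x - y) ≈⟨ +-congˡ (⁻¹-anti-homo‿- x y) ⟩
    x + (y - x) ≈⟨ +-comm x (y - x) ⟩
    (y - x) + x ≈⟨ x-y+y≈x y x ⟩
    y           ∎

  [x-y]-x≈-y : ∀ x y → (x - y) - x ≈ - y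
  [x-y]-x≈-y x y = xyx⁻¹≈y x (- y)

  [x+y]-z≈[x-z]+y : ∀ x y z → (x + y) - z ≈ (x - z) + y
  [x+y]-z≈[x-z]+y x y z = xy∙z≈xz∙y x y (- z)

  x≈z-y⇐x+y≈z : ∀ {x y z} → x + y ≈ z → x ≈ z - y
  x≈z-y⇐x+y≈z {x} {y} h = trans (sym (x+y-y≈x x y)) (+-congʳ h)

  x*-y≈-[x*y] : ∀ x y → x * - y ≈ - (x * y)
  x*-y≈-[x*y] x y = sym (-‿distribʳ-* x y)

  -- Limits in the filtration topology

  I-≤ : ∀ {K J x} → K ≤ J → I J x → I K x
  I-≤ K≤J = go (ℕₚ.≤⇒≤′ K≤J)
    where
    go : ∀ {K J x} → K ≤′ J → I J x → I K x
    go ≤′-refl      h = h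
    go (≤′-step K≤J) h = go K≤J (I-mono h)

  I-neg : ∀ {K x} → I K x → I K (- x)
  I-neg {x = x} h = I-resp (-1*x≈-x x) (I-*ˡ (- 1#) h)

  I-sub : ∀ {K x y} → I K x → I K y → I K (x - y)
  I-sub hx hy = I-+ hx (I-neg hy)

  I-*-≤ : ∀ {K j k x y} → K ≤ j +ℕ k → I j x → I k y → I K (x * y)
  I-*-≤ K≤j+k hx hy = I-≤ K≤j+k (I-mul hx hy)

  I-sub-sym : ∀ {K x y} → I K (x - y) → I K (y - x)
  I-sub-sym {x = x} {y} h = I-resp (⁻¹-anti-homo‿- x y) (I-neg h)

  I-sub-trans : ∀ {K x y z} → I K (x - y) → I K (y - z) → I K (x - z)
  I-sub-trans {x = x} {y} {z} h₁ h₂ = I-resp (x-y+[y-z]≈x-z x y z) (I-+ h₁ h₂)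

  I-separates : ∀ {x y} → (∀ K → I K (x - y)) → x ≈ y
  I-separates h = x∙y⁻¹≈ε⇒x≈y _ _ (I-sep h)

  HasLimit-rate : ∀ {s x} → (∀ n → I n (s n - x)) → HasLimit R Fl s x
  HasLimit-rate h K = K , λ p K≤p → I-≤ K≤p (h p)

  HasLimit-unique : ∀ {s x y} → HasLimit R Fl s x → HasLimit R Fl s y → x ≈ y
  HasLimit-unique hx hy = I-separates λ K →
    let (n₁ , h₁) = hx K
        (n₂ , h₂) = hy K
        p         = n₁ ⊔ n₂
    in I-sub-trans (I-sub-sym (h₁ p (ℕₚ.m≤m⊔n n₁ n₂))) (h₂ p (ℕₚ.m≤n⊔m n₁ n₂))

  HasLimit-*ˡ : ∀ a {s x} → HasLimit R Fl s x → HasLimit R Fl (λ n → a * s n) (a * x)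
  HasLimit-*ˡ a h K = let (n , hn) = h K in
    n , λ p n≤p → I-resp (x[y-z]≈xy-xz a _ _) (I-*ˡ a (hn p n≤p))

  HasLimit-*ʳ : ∀ a {s x} → HasLimit R Fl s x → HasLimit R Fl (λ n → s n * a) (x * a)
  HasLimit-*ʳ a h K = let (n , hn) = h K in
    n , λ p n≤p → I-resp ([y-z]x≈yx-zx a _ _) (I-*ʳ a (hn p n≤p))

  Cauchy-≤ : ∀ {s} → (∀ K → Σ ℕ λ n → ∀ p q → n ≤ p → p ≤ q → I K (s p - s q)) → Cauchy R Fl s
  Cauchy-≤ {s} h K = n , close
    where
    n = proj₁ (h K)
    close : ∀ p q → n ≤ p → n ≤ q → I K (s p - s q)
    close p q n≤p n≤q with ℕₚ.≤-total p q
    ... | inj₁ p≤q = proj₂ (h K) p q n≤p p≤q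
    ... | inj₂ q≤p = I-sub-sym (proj₂ (h K) q p n≤q q≤p)

  psum-tail : ∀ {a} → (∀ l → I l (a l)) → ∀ {p q} → p ≤′ q → I p (psum R Fl a q - psum R Fl a p)
  psum-tail ha {p} ≤′-refl = I-resp (sym (-‿inverseʳ _)) (I-zero p)
  psum-tail ha {p} (≤′-step {q} p≤q) =
    I-resp (sym ([x+y]-z≈[x-z]+y _ _ _)) (I-+ (psum-tail ha p≤q) (I-≤ (ℕₚ.≤′⇒≤ p≤q) (ha q)))

  Cauchy-psum : ∀ {a} → (∀ l → I l (a l)) → Cauchy R Fl (psum R Fl a)
  Cauchy-psum ha = Cauchy-≤ λ K → K , λ p q K≤p p≤q →
    I-sub-sym (I-≤ K≤p (psum-tail ha (ℕₚ.≤⇒≤′ p≤q)))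

  -- Finite sums and finite matrices

  fsum≡sum : ∀ {m} (f : Fin m → Carrier) → fsum R f ≡ sum f
  fsum≡sum {zero}  f = ≡-refl
  fsum≡sum {suc m} f = cong (f Fin.zero +_) (fsum≡sum (λ i → f (Fin.suc i)))

  fsum-cong : ∀ {m} {f g : Fin m → Carrier} → (∀ i → f i ≈ g i) → fsum R f ≈ fsum R g
  fsum-cong {f = f} {g} f≈g = subst₂ _≈_ (≡-sym (fsum≡sum f)) (≡-sym (fsum≡sum g)) (sum-cong-≋ f≈g)

  fsum-zero : ∀ m → fsum R {m} (λ _ → 0#) ≈ 0#
  fsum-zero m = subst (_≈ 0#) (≡-sym (fsum≡sum {m} (λ _ → 0#))) (sum-replicate-zero m)

  fsum-+ : ∀ {m} (f g : Fin m → Carrier) → fsum R (λ i → f i + g i) ≈ fsum R f + fsum R g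
  fsum-+ f g = subst₂ _≈_ (≡-sym (fsum≡sum (λ i → f i + g i)))
                 (≡-sym (cong₂ _+_ (fsum≡sum f) (fsum≡sum g))) (∑-distrib-+ f g)

  fsum-comm : ∀ {m n} (f : Fin m → Fin n → Carrier) →
              fsum R (λ i → fsum R (λ j → f i j)) ≈ fsum R (λ j → fsum R (λ i → f i j))
  fsum-comm f = subst₂ _≈_ (≡-sym (double f)) (≡-sym (double (λ j i → f i j))) (∑-comm f)
    where
    double : ∀ {m n} (g : Fin m → Fin n → Carrier) →
             fsum R (λ i → fsum R (λ j → g i j)) ≡ sum (λ i → sum (λ j → g i j))
    double g = ≡-trans (fsum≡sum (λ i → fsum R (λ j → g i j))) (sum-cong-≗ (λ i → fsum≡sum (g i)))

  fsum-*ˡ : ∀ {m} x (f : Fin m → Carrier) → x * fsum R f ≈ fsum R (λ i → x * f i)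
  fsum-*ˡ x f = subst₂ _≈_ (cong (x *_) (≡-sym (fsum≡sum f))) (≡-sym (fsum≡sum (λ i → x * f i)))
                  (*-distribˡ-sum x f)

  fsum-*ʳ : ∀ {m} x (f : Fin m → Carrier) → fsum R f * x ≈ fsum R (λ i → f i * x)
  fsum-*ʳ x f = subst₂ _≈_ (cong (_* x) (≡-sym (fsum≡sum f))) (≡-sym (fsum≡sum (λ i → f i * x)))
                  (*-distribʳ-sum x f)

  fsum-sub : ∀ {m} (f g : Fin m → Carrier) → fsum R (λ i → f i - g i) ≈ fsum R f - fsum R g
  fsum-sub f g = begin
    fsum R (λ i → f i - g i)             ≈⟨ fsum-+ f (λ i → - g i) ⟩
    fsum R f + fsum R (λ i → - g i)      ≈⟨ +-congˡ (fsum-cong (λ i → -1*x≈-x (g i))) ⟨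
    fsum R f + fsum R (λ i → - 1# * g i) ≈⟨ +-congˡ (fsum-*ˡ (- 1#) g) ⟨
    fsum R f + - 1# * fsum R g           ≈⟨ +-congˡ (-1*x≈-x (fsum R g)) ⟩
    fsum R f - fsum R g                  ∎

  fsum-*-sub : ∀ {m} (f g h : Fin m → Carrier) →
    fsum R (λ l → f l * (g l - h l)) ≈ fsum R (λ l → f l * g l) - fsum R (λ l → f l * h l)
  fsum-*-sub {m} f g h =
    trans (fsum-cong {m} (λ l → x[y-z]≈xy-xz (f l) (g l) (h l))) (fsum-sub (λ l → f l * g l) (λ l → f l * h l))

  fsum-sub-* : ∀ {m} (f g h : Fin m → Carrier) →
    fsum R (λ l → (g l - h l) * f l) ≈ fsum R (λ l → g l * f l) - fsum R (λ l → h l * f l)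
  fsum-sub-* {m} f g h =
    trans (fsum-cong {m} (λ l → [y-z]x≈yx-zx (f l) (g l) (h l))) (fsum-sub (λ l → g l * f l) (λ l → h l * f l))

  fsum-I : ∀ {m K} (f : Fin m → Carrier) → (∀ i → I K (f i)) → I K (fsum R f)
  fsum-I {zero}  f h = I-zero _
  fsum-I {suc m} f h = I-+ (h Fin.zero) (fsum-I (λ i → f (Fin.suc i)) (λ i → h (Fin.suc i)))

  fsum-split : ∀ m d (f : ℕ → Carrier) →
    fsum R {m +ℕ d} (λ i → f (toℕ i)) ≈ fsum R {m} (λ i → f (toℕ i)) + fsum R {d} (λ t → f (m +ℕ toℕ t))
  fsum-split zero    d f = sym (+-identityˡ _)
  fsum-split (suc m) d f = trans (+-congˡ (fsum-split m d (λ l → f (suc l)))) (sym (+-assoc _ _ _))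

  fsum-snoc : ∀ m (f : ℕ → Carrier) → fsum R {suc m} (λ i → f (toℕ i)) ≈ fsum R {m} (λ i → f (toℕ i)) + f m
  fsum-snoc zero    f = trans (+-identityʳ _) (sym (+-identityˡ _))
  fsum-snoc (suc m) f = trans (+-congˡ (fsum-snoc m (λ l → f (suc l)))) (sym (+-assoc _ _ _))

  psum≈fsum : ∀ (f : ℕ → Carrier) p → psum R Fl f p ≈ fsum R {p} (λ i → f (toℕ i))
  psum≈fsum f zero    = refl
  psum≈fsum f (suc p) = trans (+-congʳ (psum≈fsum f p)) (sym (fsum-snoc p f))

  fsum-fidˡ : ∀ {m} (i : Fin m) (f : Fin m → Carrier) → fsum R (λ l → fid R i l * f l) ≈ f i
  fsum-fidˡ {suc m} Fin.zero f = begin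
    1# * f Fin.zero + fsum R (λ l → 0# * f (Fin.suc l)) ≈⟨ +-cong (*-identityˡ _) (fsum-cong {m} (λ l → zeroˡ _)) ⟩
    f Fin.zero + fsum R {m} (λ _ → 0#)                 ≈⟨ +-congˡ (fsum-zero m) ⟩
    f Fin.zero + 0#                                     ≈⟨ +-identityʳ _ ⟩
    f Fin.zero                                          ∎
  fsum-fidˡ {suc m} (Fin.suc i) f = begin
    0# * f Fin.zero + fsum R (λ l → fid R i l * f (Fin.suc l)) ≈⟨ +-cong (zeroˡ _) (fsum-fidˡ i (λ l → f (Fin.suc l))) ⟩
    0# + f (Fin.suc i)                                         ≈⟨ +-identityˡ _ ⟩
    f (Fin.suc i)                                              ∎

  fsum-fidʳ : ∀ {m} (k : Fin m) (f : Fin m → Carrier) → fsum R (λ l → f l * fid R l k) ≈ f k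
  fsum-fidʳ {suc m} Fin.zero f = begin
    f Fin.zero * 1# + fsum R (λ l → f (Fin.suc l) * 0#) ≈⟨ +-cong (*-identityʳ _) (fsum-cong {m} (λ l → zeroʳ _)) ⟩
    f Fin.zero + fsum R {m} (λ _ → 0#)                 ≈⟨ +-congˡ (fsum-zero m) ⟩
    f Fin.zero + 0#                                     ≈⟨ +-identityʳ _ ⟩
    f Fin.zero                                          ∎
  fsum-fidʳ {suc m} (Fin.suc k) f = begin
    f Fin.zero * 0# + fsum R (λ l → f (Fin.suc l) * fid R l k) ≈⟨ +-cong (zeroʳ _) (fsum-fidʳ k (λ l → f (Fin.suc l))) ⟩
    0# + f (Fin.suc k)                                         ≈⟨ +-identityˡ _ ⟩
    f (Fin.suc k)                                              ∎

  fmul-assoc : ∀ {m} (A B C : FMat R m) i k → fmul R (fmul R A B) C i k ≈ fmul R A (fmul R B C) i k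
  fmul-assoc {m} A B C i k = begin
    fsum R (λ l → fsum R (λ l′ → A i l′ * B l′ l) * C l k)
      ≈⟨ fsum-cong {m} (λ l → fsum-*ʳ (C l k) (λ l′ → A i l′ * B l′ l)) ⟩
    fsum R (λ l → fsum R (λ l′ → A i l′ * B l′ l * C l k))
      ≈⟨ fsum-comm (λ l l′ → A i l′ * B l′ l * C l k) ⟩
    fsum R (λ l′ → fsum R (λ l → A i l′ * B l′ l * C l k))
      ≈⟨ fsum-cong {m} (λ l′ → fsum-cong {m} (λ l → *-assoc _ _ _)) ⟩
    fsum R (λ l′ → fsum R (λ l → A i l′ * (B l′ l * C l k)))
      ≈⟨ fsum-cong {m} (λ l′ → fsum-*ˡ (A i l′) (λ l → B l′ l * C l k)) ⟨
    fsum R (λ l′ → A i l′ * fsum R (λ l → B l′ l * C l k)) ∎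

  IsRightFInverse : ∀ {m} → FMat R m → FMat R m → Set ℓ
  IsRightFInverse A B = ∀ i k → fmul R A B i k ≈ fid R i k

  FInverse-unique : ∀ {m} {A Y Z : FMat R m} → IsRightFInverse Z A → IsRightFInverse A Y → ∀ i k → Z i k ≈ Y i k
  FInverse-unique {A = A} {Y} {Z} ZA≈1 AY≈1 i k = begin
    Z i k                                      ≈⟨ fsum-fidʳ k (Z i) ⟨
    fsum R (λ l → Z i l * fid R l k)           ≈⟨ fsum-cong (λ l → *-congˡ (AY≈1 l k)) ⟨
    fmul R Z (fmul R A Y) i k                  ≈⟨ fmul-assoc Z A Y i k ⟨
    fmul R (fmul R Z A) Y i k                  ≈⟨ fsum-cong (λ l → *-congʳ (ZA≈1 i l)) ⟩
    fsum R (λ l → fid R i l * Y l k)           ≈⟨ fsum-fidˡ i (λ l → Y l k) ⟩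
    Y i k                                      ∎

  -- Units and the geometric series

  IsUnit-resp : ∀ {x y} → x ≈ y → IsUnit R x → IsUnit R y
  IsUnit-resp x≈y (u , ux≈1 , xu≈1) = u , trans (*-congˡ (sym x≈y)) ux≈1 , trans (*-congʳ (sym x≈y)) xu≈1

  IsUnit-* : ∀ {x y} → IsUnit R x → IsUnit R y → IsUnit R (x * y)
  IsUnit-* {x} {y} (u , ux≈1 , xu≈1) (v , vy≈1 , yv≈1) = v * u , left , right
    where
    left : (v * u) * (x * y) ≈ 1#
    left = begin
      (v * u) * (x * y) ≈⟨ *-assoc v u (x * y) ⟩
      v * (u * (x * y)) ≈⟨ *-congˡ (*-assoc u x y) ⟨
      v * ((u * x) * y) ≈⟨ *-congˡ (*-congʳ ux≈1) ⟩
      v * (1# * y)      ≈⟨ *-congˡ (*-identityˡ y) ⟩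
      v * y             ≈⟨ vy≈1 ⟩
      1#                ∎
    right : (x * y) * (v * u) ≈ 1#
    right = begin
      (x * y) * (v * u) ≈⟨ *-assoc x y (v * u) ⟩
      x * (y * (v * u)) ≈⟨ *-congˡ (*-assoc y v u) ⟨
      x * ((y * v) * u) ≈⟨ *-congˡ (*-congʳ yv≈1) ⟩
      x * (1# * u)      ≈⟨ *-congˡ (*-identityˡ u) ⟩
      x * u             ≈⟨ xu≈1 ⟩
      1#                ∎

  I-^ : ∀ {x} → I 1 x → ∀ n → I n (x ^ n)
  I-^ h zero    = I-top _
  I-^ h (suc n) = I-mul h (I-^ h n)

  geometric-sumˡ : ∀ x n → (1# - x) * psum R Fl (x ^_) n ≈ 1# - x ^ n
  geometric-sumˡ x zero    = trans (zeroʳ _) (sym (-‿inverseʳ 1#))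
  geometric-sumˡ x (suc n) = begin
    (1# - x) * (psum R Fl (x ^_) n + x ^ n)              ≈⟨ distribˡ (1# - x) _ _ ⟩
    (1# - x) * psum R Fl (x ^_) n + (1# - x) * x ^ n     ≈⟨ +-cong (geometric-sumˡ x n) ([y-z]x≈yx-zx (x ^ n) 1# x) ⟩
    (1# - x ^ n) + (1# * x ^ n - x * x ^ n)              ≈⟨ +-congˡ (+-congʳ (*-identityˡ (x ^ n))) ⟩
    (1# - x ^ n) + (x ^ n - x ^ suc n)                   ≈⟨ x-y+[y-z]≈x-z 1# (x ^ n) (x ^ suc n) ⟩
    1# - x ^ suc n                                       ∎

  geometric-sumʳ : ∀ x n → psum R Fl (x ^_) n * (1# - x) ≈ 1# - x ^ n
  geometric-sumʳ x zero    = trans (zeroˡ _) (sym (-‿inverseʳ 1#))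
  geometric-sumʳ x (suc n) = begin
    (psum R Fl (x ^_) n + x ^ n) * (1# - x)              ≈⟨ distribʳ (1# - x) _ _ ⟩
    psum R Fl (x ^_) n * (1# - x) + x ^ n * (1# - x)     ≈⟨ +-cong (geometric-sumʳ x n) (x[y-z]≈xy-xz (x ^ n) 1# x) ⟩
    (1# - x ^ n) + (x ^ n * 1# - x ^ n * x)              ≈⟨ +-congˡ (+-cong (*-identityʳ (x ^ n)) (-‿cong ^-suc)) ⟩
    (1# - x ^ n) + (x ^ n - x ^ suc n)                   ≈⟨ x-y+[y-z]≈x-z 1# (x ^ n) (x ^ suc n) ⟩
    1# - x ^ suc n                                       ∎
    where
    ^-suc : x ^ n * x ≈ x ^ suc n
    ^-suc = begin
      x ^ n * x         ≈⟨ *-congˡ (*-identityʳ x) ⟨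
      x ^ n * x ^ 1     ≈⟨ ^-homo-* x n 1 ⟨
      x ^ (n +ℕ 1)      ≈⟨ ^-congʳ x (ℕₚ.+-comm n 1) ⟩
      x ^ suc n         ∎

  -- Banded matrices

  Banded : Mat R Fl → Set ℓ'
  Banded X = ∀ j k → I ∣ j - k ∣ (X j k)

  UnitDiagonal : Mat R Fl → Set (c ⊔ˡ ℓ)
  UnitDiagonal X = ∀ j → IsUnit R (X j j)

  RightInverseOn : ℕ → Mat R Fl → Mat R Fl → Set ℓ
  RightInverseOn m X Y = IsRightFInverse (trunc R X m) (trunc R Y m)

  RightInverseOn⇒δ : ∀ {m X Y j k} → RightInverseOn m X Y → j < m → k < m →
                      fsum R {m} (λ l → X j (toℕ l) * Y (toℕ l) k) ≈ δ R Fl j k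
  RightInverseOn⇒δ {m} {X} {Y} XY≈1 =
    ∀Fin⇒∀< (λ j k → fsum R {m} (λ l → X j (toℕ l) * Y (toℕ l) k) ≈ δ R Fl j k) XY≈1

  record BandedRightInverse (m : ℕ) (X : Mat R Fl) : Set (c ⊔ˡ ℓ ⊔ˡ ℓ') where
    field
      inverse      : Mat R Fl
      banded       : Banded inverse
      unitDiagonal : UnitDiagonal inverse
      rightInverse : RightInverseOn m X inverse

  module _ (complete : Complete R Fl) where

    1-x-isUnit : ∀ {x} → I 1 x → IsUnit R (1# - x)
    1-x-isUnit {x} x∈I₁ = y , y[1-x]≈1 , [1-x]y≈1
      where
      series = complete (psum R Fl (x ^_)) (Cauchy-psum (I-^ x∈I₁))
      y = proj₁ series
      partial-sums→y = proj₂ series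
      →1 : ∀ {s} → (∀ n → s n ≈ 1# - x ^ n) → HasLimit R Fl s 1#
      →1 s≈ = HasLimit-rate λ n →
        I-resp (sym (trans (+-congʳ (s≈ n)) ([x-y]-x≈-y 1# (x ^ n)))) (I-neg (I-^ x∈I₁ n))
      y[1-x]≈1 : y * (1# - x) ≈ 1#
      y[1-x]≈1 = HasLimit-unique (HasLimit-*ʳ (1# - x) partial-sums→y) (→1 (geometric-sumʳ x))
      [1-x]y≈1 : (1# - x) * y ≈ 1#
      [1-x]y≈1 = HasLimit-unique (HasLimit-*ˡ (1# - x) partial-sums→y) (→1 (geometric-sumˡ x))

    +-isUnit : ∀ {u e} → IsUnit R u → I 1 e → IsUnit R (u + e)
    +-isUnit {u} {e} u-unit@(u⁻¹ , _ , uu⁻¹≈1) e∈I₁ =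
      IsUnit-resp factorisation (IsUnit-* u-unit (1-x-isUnit (I-neg (I-*ˡ u⁻¹ e∈I₁))))
      where
      factorisation : u * (1# - - (u⁻¹ * e)) ≈ u + e
      factorisation = begin
        u * (1# - - (u⁻¹ * e))   ≈⟨ x[y-z]≈xy-xz u 1# _ ⟩
        u * 1# - u * - (u⁻¹ * e) ≈⟨ +-cong (*-identityʳ u) (-‿cong (x*-y≈-[x*y] u _)) ⟩
        u - - (u * (u⁻¹ * e))    ≈⟨ +-congˡ (-‿involutive _) ⟩
        u + u * (u⁻¹ * e)        ≈⟨ +-congˡ (*-assoc u u⁻¹ e) ⟨
        u + (u * u⁻¹) * e        ≈⟨ +-congˡ (*-congʳ uu⁻¹≈1) ⟩
        u + 1# * e               ≈⟨ +-congˡ (*-identityˡ e) ⟩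
        u + e                    ∎

    module SchurComplement (m : ℕ) (X : Mat R Fl) (X-banded : Banded X) (X-unitDiagonal : UnitDiagonal X) where
      a a⁻¹ : Carrier
      a   = X 0 0
      a⁻¹ = proj₁ (X-unitDiagonal 0)

      a⁻¹a≈1 : a⁻¹ * a ≈ 1#
      a⁻¹a≈1 = proj₁ (proj₂ (X-unitDiagonal 0))

      aa⁻¹≈1 : a * a⁻¹ ≈ 1#
      aa⁻¹≈1 = proj₂ (proj₂ (X-unitDiagonal 0))

      row col : ℕ → Carrier
      row k = X 0 (suc k)
      col j = X (suc j) 0

      S : Mat R Fl
      S j k = X (suc j) (suc k) - col j * (a⁻¹ * row k)

      S-banded : Banded S
      S-banded j k = I-sub (X-banded (suc j) (suc k))
        (I-*-≤ (∣-∣≤suc+suc j k) (X-banded (suc j) 0) (I-*ˡ a⁻¹ (X-banded 0 (suc k))))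

      S-unitDiagonal : UnitDiagonal S
      S-unitDiagonal j = +-isUnit (X-unitDiagonal (suc j))
        (I-neg (I-*-≤ (s≤s z≤n) (X-banded (suc j) 0) (I-*ˡ a⁻¹ (X-banded 0 (suc j)))))

      X≈S+col*a⁻¹*row : ∀ j l → X (suc j) (suc l) ≈ S j l + col j * (a⁻¹ * row l)
      X≈S+col*a⁻¹*row j l = sym (x-y+y≈x _ _)

      module Extension (T : Mat R Fl) (T-banded : Banded T) (T-unitDiagonal : UnitDiagonal T)
                       (ST≈1 : RightInverseOn m S T) where
        rowT Tcol : ℕ → Carrier
        rowT k = fsum R {m} (λ l → row (toℕ l) * T (toℕ l) k)
        Tcol j = fsum R {m} (λ l → T j (toℕ l) * col (toℕ l))

        rowTcol : Carrier
        rowTcol = fsum R {m} (λ l → row (toℕ l) * Tcol (toℕ l))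

        -- Block inverse of X = [[a, row], [col, D]], where S = D - col a⁻¹ row and T = S⁻¹.
        B : Mat R Fl
        B zero    zero    = a⁻¹ + (a⁻¹ * rowTcol) * a⁻¹
        B zero    (suc k) = - (a⁻¹ * rowT k)
        B (suc j) zero    = - (Tcol j * a⁻¹)
        B (suc j) (suc k) = T j k

        rowT∈I : ∀ k → I (suc k) (rowT k)
        rowT∈I k = fsum-I {m} _ λ l →
          I-*-≤ (ℕₚ.m≤n+∣n-m∣ (suc k) (suc (toℕ l))) (X-banded 0 (suc (toℕ l))) (T-banded (toℕ l) k)

        Tcol∈I : ∀ j → I (suc j) (Tcol j)
        Tcol∈I j = fsum-I {m} _ λ l →
          I-*-≤ (ℕₚ.m≤∣m-n∣+n (suc j) (suc (toℕ l))) (T-banded j (toℕ l)) (X-banded (suc (toℕ l)) 0)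

        rowTcol∈I : I 1 rowTcol
        rowTcol∈I = fsum-I {m} _ λ l → I-*ʳ (Tcol (toℕ l)) (I-≤ (s≤s z≤n) (X-banded 0 (suc (toℕ l))))

        B-banded : Banded B
        B-banded zero    zero    = I-top _
        B-banded zero    (suc k) = I-neg (I-*ˡ a⁻¹ (rowT∈I k))
        B-banded (suc j) zero    = I-neg (I-*ʳ a⁻¹ (Tcol∈I j))
        B-banded (suc j) (suc k) = T-banded j k

        B-unitDiagonal : UnitDiagonal B
        B-unitDiagonal zero    = +-isUnit (a , aa⁻¹≈1 , a⁻¹a≈1) (I-*ʳ a⁻¹ (I-*ˡ a⁻¹ rowTcol∈I))
        B-unitDiagonal (suc j) = T-unitDiagonal j

        sum-*-neg-*a⁻¹ : ∀ (f g : Fin m → Carrier) →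
          fsum R {m} (λ l → f l * - (g l * a⁻¹)) ≈ - (fsum R {m} (λ l → f l * g l) * a⁻¹)
        sum-*-neg-*a⁻¹ f g = begin
          fsum R {m} (λ l → f l * - (g l * a⁻¹))   ≈⟨ fsum-cong {m} (λ l → trans (x*-y≈-[x*y] _ _) (-‿cong (sym (*-assoc _ _ _)))) ⟩
          fsum R {m} (λ l → - (f l * g l * a⁻¹))   ≈⟨ fsum-cong {m} (λ l → -1*x≈-x _) ⟨
          fsum R {m} (λ l → - 1# * (f l * g l * a⁻¹)) ≈⟨ fsum-*ˡ (- 1#) (λ l → f l * g l * a⁻¹) ⟨
          - 1# * fsum R {m} (λ l → f l * g l * a⁻¹) ≈⟨ -1*x≈-x _ ⟩
          - fsum R {m} (λ l → f l * g l * a⁻¹)     ≈⟨ -‿cong (fsum-*ʳ a⁻¹ (λ l → f l * g l)) ⟨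
          - (fsum R {m} (λ l → f l * g l) * a⁻¹)   ∎

        sum-X-split : ∀ j (h : Fin m → Carrier) →
          fsum R {m} (λ l → X (suc j) (suc (toℕ l)) * h l)
            ≈ fsum R {m} (λ l → S j (toℕ l) * h l) + (col j * a⁻¹) * fsum R {m} (λ l → row (toℕ l) * h l)
        sum-X-split j h = begin
          fsum R {m} (λ l → X (suc j) (suc (toℕ l)) * h l)
            ≈⟨ fsum-cong {m} (λ l → trans (*-congʳ (X≈S+col*a⁻¹*row j (toℕ l))) (distribʳ _ _ _)) ⟩
          fsum R {m} (λ l → S j (toℕ l) * h l + col j * (a⁻¹ * row (toℕ l)) * h l)
            ≈⟨ fsum-+ (λ l → S j (toℕ l) * h l) (λ l → col j * (a⁻¹ * row (toℕ l)) * h l) ⟩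
          fsum R {m} (λ l → S j (toℕ l) * h l) + fsum R {m} (λ l → col j * (a⁻¹ * row (toℕ l)) * h l)
            ≈⟨ +-congˡ (fsum-cong {m} (λ l → trans (*-congʳ (sym (*-assoc _ _ _))) (*-assoc _ _ _))) ⟩
          fsum R {m} (λ l → S j (toℕ l) * h l) + fsum R {m} (λ l → (col j * a⁻¹) * (row (toℕ l) * h l))
            ≈⟨ +-congˡ (fsum-*ˡ (col j * a⁻¹) (λ l → row (toℕ l) * h l)) ⟨
          fsum R {m} (λ l → S j (toℕ l) * h l) + (col j * a⁻¹) * fsum R {m} (λ l → row (toℕ l) * h l) ∎

        S-Tcol≈col : ∀ (i : Fin m) → fsum R {m} (λ l → S (toℕ i) (toℕ l) * Tcol (toℕ l)) ≈ col (toℕ i)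
        S-Tcol≈col i = begin
          fmul R (trunc R S m) (fmul R (trunc R T m) column) i i ≈⟨ fmul-assoc (trunc R S m) (trunc R T m) column i i ⟨
          fmul R (fmul R (trunc R S m) (trunc R T m)) column i i ≈⟨ fsum-cong {m} (λ l → *-congʳ (ST≈1 i l)) ⟩
          fsum R {m} (λ l → fid R i l * column l i)                  ≈⟨ fsum-fidˡ i (λ l → column l i) ⟩
          col (toℕ i)                                            ∎
          where
          column : FMat R m
          column l _ = col (toℕ l)

        XB≈1 : RightInverseOn (suc m) X B
        XB≈1 Fin.zero Fin.zero = begin
          a * (a⁻¹ + (a⁻¹ * rowTcol) * a⁻¹) + fsum R {m} (λ l → row (toℕ l) * - (Tcol (toℕ l) * a⁻¹))
            ≈⟨ +-cong (distribˡ a a⁻¹ _) (sum-*-neg-*a⁻¹ (λ l → row (toℕ l)) (λ l → Tcol (toℕ l))) ⟩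
          (a * a⁻¹ + a * ((a⁻¹ * rowTcol) * a⁻¹)) - rowTcol * a⁻¹
            ≈⟨ +-congʳ (+-cong aa⁻¹≈1 cancel) ⟩
          (1# + rowTcol * a⁻¹) - rowTcol * a⁻¹
            ≈⟨ x+y-y≈x 1# _ ⟩
          1# ∎
          where
          cancel : a * ((a⁻¹ * rowTcol) * a⁻¹) ≈ rowTcol * a⁻¹
          cancel = begin
            a * ((a⁻¹ * rowTcol) * a⁻¹) ≈⟨ *-congˡ (*-assoc a⁻¹ rowTcol a⁻¹) ⟩
            a * (a⁻¹ * (rowTcol * a⁻¹)) ≈⟨ *-assoc a a⁻¹ _ ⟨
            (a * a⁻¹) * (rowTcol * a⁻¹) ≈⟨ *-congʳ aa⁻¹≈1 ⟩
            1# * (rowTcol * a⁻¹)        ≈⟨ *-identityˡ _ ⟩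
            rowTcol * a⁻¹               ∎
        XB≈1 Fin.zero (Fin.suc k) = begin
          a * - (a⁻¹ * rowT (toℕ k)) + rowT (toℕ k)   ≈⟨ +-congʳ (x*-y≈-[x*y] a _) ⟩
          - (a * (a⁻¹ * rowT (toℕ k))) + rowT (toℕ k) ≈⟨ +-congʳ (-‿cong cancel) ⟩
          - rowT (toℕ k) + rowT (toℕ k)               ≈⟨ -‿inverseˡ _ ⟩
          0#                                          ∎
          where
          cancel : a * (a⁻¹ * rowT (toℕ k)) ≈ rowT (toℕ k)
          cancel = trans (sym (*-assoc a a⁻¹ _)) (trans (*-congʳ aa⁻¹≈1) (*-identityˡ _))
        XB≈1 (Fin.suc i) Fin.zero = begin
          col j * (a⁻¹ + (a⁻¹ * rowTcol) * a⁻¹) + fsum R {m} (λ l → X (suc j) (suc (toℕ l)) * - (Tcol (toℕ l) * a⁻¹))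
            ≈⟨ +-cong (distribˡ (col j) a⁻¹ _) (sum-*-neg-*a⁻¹ (λ l → X (suc j) (suc (toℕ l))) (λ l → Tcol (toℕ l))) ⟩
          (col j * a⁻¹ + col j * ((a⁻¹ * rowTcol) * a⁻¹)) - fsum R {m} (λ l → X (suc j) (suc (toℕ l)) * Tcol (toℕ l)) * a⁻¹
            ≈⟨ +-cong (+-congˡ reassoc) (-‿cong (*-congʳ (trans (sum-X-split j (λ l → Tcol (toℕ l))) (+-congʳ (S-Tcol≈col i))))) ⟩
          (col j * a⁻¹ + ((col j * a⁻¹) * rowTcol) * a⁻¹) - (col j + (col j * a⁻¹) * rowTcol) * a⁻¹
            ≈⟨ +-congˡ (-‿cong (distribʳ a⁻¹ (col j) _)) ⟩
          (col j * a⁻¹ + ((col j * a⁻¹) * rowTcol) * a⁻¹) - (col j * a⁻¹ + ((col j * a⁻¹) * rowTcol) * a⁻¹)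
            ≈⟨ -‿inverseʳ _ ⟩
          0# ∎
          where
          j = toℕ i
          reassoc : col j * ((a⁻¹ * rowTcol) * a⁻¹) ≈ ((col j * a⁻¹) * rowTcol) * a⁻¹
          reassoc = trans (sym (*-assoc (col j) _ a⁻¹)) (*-congʳ (sym (*-assoc (col j) a⁻¹ rowTcol)))
        XB≈1 (Fin.suc i) (Fin.suc k) = begin
          col j * - (a⁻¹ * rowT (toℕ k)) + fsum R {m} (λ l → X (suc j) (suc (toℕ l)) * T (toℕ l) (toℕ k))
            ≈⟨ +-cong (trans (x*-y≈-[x*y] _ _) (-‿cong (sym (*-assoc _ _ _)))) (sum-X-split j (λ l → T (toℕ l) (toℕ k))) ⟩
          - ((col j * a⁻¹) * rowT (toℕ k)) + (fmul R (trunc R S m) (trunc R T m) i k + (col j * a⁻¹) * rowT (toℕ k))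
            ≈⟨ +-congˡ (+-comm _ _) ⟩
          - ((col j * a⁻¹) * rowT (toℕ k)) + ((col j * a⁻¹) * rowT (toℕ k) + fmul R (trunc R S m) (trunc R T m) i k)
            ≈⟨ \\-leftDividesʳ _ _ ⟩
          fmul R (trunc R S m) (trunc R T m) i k
            ≈⟨ ST≈1 i k ⟩
          fid R i k ∎
          where
          j = toℕ i

    bandedRightInverse : ∀ m X → Banded X → UnitDiagonal X → BandedRightInverse m X
    bandedRightInverse zero X X-banded X-unitDiagonal = record
      { inverse = X ; banded = X-banded ; unitDiagonal = X-unitDiagonal ; rightInverse = λ () }
    bandedRightInverse (suc m) X X-banded X-unitDiagonal = record
      { inverse = B ; banded = B-banded ; unitDiagonal = B-unitDiagonal ; rightInverse = XB≈1 }
      where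
      open SchurComplement m X X-banded X-unitDiagonal
      open BandedRightInverse (bandedRightInverse m S S-banded S-unitDiagonal)
      open Extension inverse banded unitDiagonal rightInverse

    -- Y has a banded right inverse W as well, and uniqueness of inverses forces X = W on the block.
    leftInverse : ∀ {m X} (Y : BandedRightInverse m X) → RightInverseOn m (BandedRightInverse.inverse Y) X
    leftInverse {m} {X} Y i k = begin
      fmul R (trunc R inverse m) (trunc R X m) i k ≈⟨ fsum-cong {m} (λ l → *-congˡ (X≈W l k)) ⟩
      fmul R (trunc R inverse m) (trunc R W m) i k ≈⟨ YW≈1 i k ⟩
      fid R i k                                    ∎
      where
      open BandedRightInverse Y
      Wr = bandedRightInverse m inverse banded unitDiagonal
      W = BandedRightInverse.inverse Wr
      YW≈1 = BandedRightInverse.rightInverse Wr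
      X≈W : ∀ l k → X (toℕ l) (toℕ k) ≈ W (toℕ l) (toℕ k)
      X≈W = FInverse-unique rightInverse YW≈1

    module InverseLimit (M : Mat R Fl) (M-banded : Banded M) (M-unitDiagonal : UnitDiagonal M) where
      private
        module M⁻¹ p = BandedRightInverse (bandedRightInverse p M M-banded M-unitDiagonal)

      A : ℕ → Mat R Fl
      A = M⁻¹.inverse

      A-banded : ∀ p → Banded (A p)
      A-banded = M⁻¹.banded

      MA≈1 : ∀ p → RightInverseOn p M (A p)
      MA≈1 = M⁻¹.rightInverse

      AM≈1 : ∀ p → RightInverseOn p (A p) M
      AM≈1 p = leftInverse (bandedRightInverse p M M-banded M-unitDiagonal)

      -- A (m + d) differs from A m on the m × m block only through the columns m, …, m+d-1 of M.
      A-stable : ∀ m d (i k : Fin m) →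
        I (m +ℕ m ∸ toℕ i ∸ toℕ k) (A m (toℕ i) (toℕ k) - A (m +ℕ d) (toℕ i) (toℕ k))
      A-stable m d i k = I-resp (sym difference) Z∈I
        where
        A′ = A (m +ℕ d)
        Am = trunc R (A m) m
        E : FMat R m
        E l k = fsum R {d} (λ t → M (toℕ l) (m +ℕ toℕ t) * A′ (m +ℕ toℕ t) (toℕ k))
        E∈I : ∀ l k → I (m +ℕ m ∸ toℕ l ∸ toℕ k) (E l k)
        E∈I l k = fsum-I {d} _ λ t →
          I-*-≤ (m+m∸l∸k≤∣l-m+t∣+∣m+t-k∣ m (toℕ t) (toℕ l) (toℕ k))
                (M-banded (toℕ l) (m +ℕ toℕ t)) (A-banded (m +ℕ d) (m +ℕ toℕ t) (toℕ k))
        MA′≈1-E : ∀ l k → fmul R (trunc R M m) (trunc R A′ m) l k ≈ fid R l k - E l k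
        MA′≈1-E l k = x≈z-y⇐x+y≈z (trans (sym (fsum-split m d (λ t → M (toℕ l) t * A′ t (toℕ k))))
                                         (RightInverseOn⇒δ {X = M} {A′} (MA≈1 (m +ℕ d)) (inside l) (inside k)))
          where
          inside : ∀ (l : Fin m) → toℕ l < m +ℕ d
          inside l = ℕₚ.<-≤-trans (toℕ<n l) (ℕₚ.m≤m+n m d)
        Z = fmul R Am E i k
        Z∈I : I (m +ℕ m ∸ toℕ i ∸ toℕ k) Z
        Z∈I = fsum-I {m} _ λ l →
          I-*-≤ (∸∸-lipschitzˡ (m +ℕ m) (toℕ i) (toℕ l) (toℕ k)) (A-banded m (toℕ i) (toℕ l)) (E∈I l k)
        A′≈Am-Z : A′ (toℕ i) (toℕ k) ≈ Am i k - Z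
        A′≈Am-Z = begin
          A′ (toℕ i) (toℕ k)                                 ≈⟨ fsum-fidˡ i (λ l → A′ (toℕ l) (toℕ k)) ⟨
          fsum R {m} (λ l → fid R i l * A′ (toℕ l) (toℕ k))  ≈⟨ fsum-cong {m} (λ l → *-congʳ (AM≈1 m i l)) ⟨
          fmul R (fmul R Am (trunc R M m)) (trunc R A′ m) i k ≈⟨ fmul-assoc Am (trunc R M m) (trunc R A′ m) i k ⟩
          fmul R Am (fmul R (trunc R M m) (trunc R A′ m)) i k ≈⟨ fsum-cong {m} (λ l → *-congˡ (MA′≈1-E l k)) ⟩
          fsum R {m} (λ l → Am i l * (fid R l k - E l k))     ≈⟨ fsum-*-sub (Am i) (λ l → fid R l k) (λ l → E l k) ⟩
          fsum R {m} (λ l → Am i l * fid R l k) - Z           ≈⟨ +-congʳ (fsum-fidʳ k (Am i)) ⟩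
          Am i k - Z                                          ∎
        difference : Am i k - A′ (toℕ i) (toℕ k) ≈ Z
        difference = trans (+-congˡ (-‿cong A′≈Am-Z)) (x-[x-y]≈y _ _)

      A-stable-≤ : ∀ {m m′ j k} → m ≤ m′ → j < m → k < m → I (m +ℕ m ∸ j ∸ k) (A m j k - A m′ j k)
      A-stable-≤ {m} {m′} m≤m′ = ∀Fin⇒∀< (λ j k → I (m +ℕ m ∸ j ∸ k) (A m j k - A m′ j k))
        (subst (λ n → ∀ (i k : Fin m) → I (m +ℕ m ∸ toℕ i ∸ toℕ k) (A m (toℕ i) (toℕ k) - A n (toℕ i) (toℕ k)))
               (ℕₚ.m+[n∸m]≡n m≤m′) (A-stable m (m′ ∸ m)))

      A-Cauchy : ∀ j k → Cauchy R Fl (λ p → A p j k)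
      A-Cauchy j k = Cauchy-≤ λ K → threshold j k K , λ p q h p≤q →
        I-≤ (threshold-bound j k K h) (A-stable-≤ p≤q (threshold-<ˡ j k K h) (threshold-<ʳ j k K h))

      N : Mat R Fl
      N j k = proj₁ (complete (λ p → A p j k) (A-Cauchy j k))

      A→N : ∀ j k → HasLimit R Fl (λ p → A p j k) (N j k)
      A→N j k = proj₂ (complete (λ p → A p j k) (A-Cauchy j k))

      A-N : ∀ {m j k} → j < m → k < m → I (m +ℕ m ∸ j ∸ k) (A m j k - N j k)
      A-N {m} {j} {k} j<m k<m =
        I-sub-trans (A-stable-≤ (ℕₚ.m≤n⊔m n m) j<m k<m) (proj₂ (A→N j k K) (n ⊔ m) (ℕₚ.m≤m⊔n n m))
        where
        K = m +ℕ m ∸ j ∸ k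
        n = proj₁ (A→N j k K)

      A-N-threshold : ∀ j k K {p} → threshold j k K ≤ p → I K (A p j k - N j k)
      A-N-threshold j k K h = I-≤ (threshold-bound j k K h) (A-N (threshold-<ˡ j k K h) (threshold-<ʳ j k K h))

      N-banded : Banded N
      N-banded j k = I-resp (x-[x-y]≈y _ _)
        (I-sub (A-banded p j k) (A-N-threshold j k ∣ j - k ∣ ℕₚ.≤-refl))
        where p = threshold j k ∣ j - k ∣

      N-unitDiagonal : UnitDiagonal N
      N-unitDiagonal j = IsUnit-resp (x-[x-y]≈y _ _)
        (+-isUnit (M⁻¹.unitDiagonal p j) (I-neg (A-N-threshold j j 1 ℕₚ.≤-refl)))
        where p = threshold j j 1

      MN≈δ : IsProduct R Fl M N (δ R Fl)
      MN≈δ j k K = threshold j k K , λ p h →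
        I-resp (sym (partial-sum p h)) (I-≤ (threshold-bound j k K h) (fsum-I {p} _ λ l →
          I-*-≤ (∸∸-lipschitzˡ (p +ℕ p) j (toℕ l) k) (M-banded j (toℕ l))
                (I-sub-sym (A-N (toℕ<n l) (threshold-<ʳ j k K h)))))
        where
        partial-sum : ∀ p → threshold j k K ≤ p →
          psum R Fl (λ l → M j l * N l k) p - δ R Fl j k ≈ fsum R {p} (λ l → M j (toℕ l) * (N (toℕ l) k - A p (toℕ l) k))
        partial-sum p h = begin
          psum R Fl (λ l → M j l * N l k) p - δ R Fl j k
            ≈⟨ +-cong (psum≈fsum _ p) (-‿cong (sym (RightInverseOn⇒δ {X = M} {A p} (MA≈1 p) j<p k<p))) ⟩
          fsum R {p} (λ l → M j (toℕ l) * N (toℕ l) k) - fsum R {p} (λ l → M j (toℕ l) * A p (toℕ l) k)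
            ≈⟨ fsum-*-sub {p} (λ l → M j (toℕ l)) (λ l → N (toℕ l) k) (λ l → A p (toℕ l) k) ⟨
          fsum R {p} (λ l → M j (toℕ l) * (N (toℕ l) k - A p (toℕ l) k)) ∎
          where
          j<p = threshold-<ˡ j k K h
          k<p = threshold-<ʳ j k K h

      NM≈δ : IsProduct R Fl N M (δ R Fl)
      NM≈δ j k K = threshold j k K , λ p h →
        I-resp (sym (partial-sum p h)) (I-≤ (threshold-bound j k K h) (fsum-I {p} _ λ l →
          I-*-≤ (∸∸-lipschitzʳ (p +ℕ p) j (toℕ l) k)
                (I-sub-sym (A-N (threshold-<ˡ j k K h) (toℕ<n l))) (M-banded (toℕ l) k)))
        where
        partial-sum : ∀ p → threshold j k K ≤ p →
          psum R Fl (λ l → N j l * M l k) p - δ R Fl j k ≈ fsum R {p} (λ l → (N j (toℕ l) - A p j (toℕ l)) * M (toℕ l) k)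
        partial-sum p h = begin
          psum R Fl (λ l → N j l * M l k) p - δ R Fl j k
            ≈⟨ +-cong (psum≈fsum _ p) (-‿cong (sym (RightInverseOn⇒δ {X = A p} {M} (AM≈1 p) j<p k<p))) ⟩
          fsum R {p} (λ l → N j (toℕ l) * M (toℕ l) k) - fsum R {p} (λ l → A p j (toℕ l) * M (toℕ l) k)
            ≈⟨ fsum-sub-* {p} (λ l → M (toℕ l) k) (λ l → N j (toℕ l)) (λ l → A p j (toℕ l)) ⟨
          fsum R {p} (λ l → (N j (toℕ l) - A p j (toℕ l)) * M (toℕ l) k) ∎
          where
          j<p = threshold-<ˡ j k K h
          k<p = threshold-<ʳ j k K h

      private
        module N⁻¹ m = BandedRightInverse (bandedRightInverse m N N-banded N-unitDiagonal)

      NB≈1 : ∀ m → RightInverseOn m N (N⁻¹.inverse m)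
      NB≈1 = N⁻¹.rightInverse

      M-blockInverse : ∀ m → Σ (FMat R m) (IsFInverse R (trunc R M m))
      M-blockInverse m = trunc R (A m) m , MA≈1 m , AM≈1 m

      N-blockInverse : ∀ m → Σ (FMat R m) (IsFInverse R (trunc R N m))
      N-blockInverse m = trunc R (N⁻¹.inverse m) m , NB≈1 m , leftInverse (bandedRightInverse m N N-banded N-unitDiagonal)

      M-blockInverse≈N : ∀ m A′ → IsFInverse R (trunc R M m) A′ → ∀ (i k : Fin m) →
        I (m +ℕ m ∸ toℕ i ∸ toℕ k) (A′ i k - trunc R N m i k)
      M-blockInverse≈N m A′ (_ , A′M≈1) i k =
        I-resp (+-congʳ (sym (FInverse-unique A′M≈1 (MA≈1 m) i k))) (A-N (toℕ<n i) (toℕ<n k))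

      -- On the m × m block, M - N(m)⁻¹ = M (N - A m) N(m)⁻¹.
      M-N-blockInverse : ∀ m (i k : Fin m) →
        I (m +ℕ m ∸ toℕ i ∸ toℕ k) (trunc R M m i k - trunc R (N⁻¹.inverse m) m i k)
      M-N-blockInverse m i k = I-resp difference bound
        where
        Mm = trunc R M m
        Am = trunc R (A m) m
        Bm = trunc R (N⁻¹.inverse m) m
        G : FMat R m
        G l l′ = trunc R N m l l′ - Am l l′
        GB≈1-AB : ∀ l → fmul R G Bm l k ≈ fid R l k - fmul R Am Bm l k
        GB≈1-AB l = trans (fsum-sub-* {m} (λ l′ → Bm l′ k) (λ l′ → trunc R N m l l′) (Am l)) (+-congʳ (NB≈1 m l k))
        MAB≈B : fmul R Mm (fmul R Am Bm) i k ≈ Bm i k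
        MAB≈B = begin
          fmul R Mm (fmul R Am Bm) i k         ≈⟨ fmul-assoc Mm Am Bm i k ⟨
          fmul R (fmul R Mm Am) Bm i k         ≈⟨ fsum-cong {m} (λ l → *-congʳ (MA≈1 m i l)) ⟩
          fsum R {m} (λ l → fid R i l * Bm l k) ≈⟨ fsum-fidˡ i (λ l → Bm l k) ⟩
          Bm i k                               ∎
        difference : fmul R Mm (fmul R G Bm) i k ≈ Mm i k - Bm i k
        difference = begin
          fmul R Mm (fmul R G Bm) i k                                    ≈⟨ fsum-cong {m} (λ l → *-congˡ (GB≈1-AB l)) ⟩
          fsum R {m} (λ l → Mm i l * (fid R l k - fmul R Am Bm l k))     ≈⟨ fsum-*-sub (Mm i) (λ l → fid R l k) (λ l → fmul R Am Bm l k) ⟩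
          fsum R {m} (λ l → Mm i l * fid R l k) - fmul R Mm (fmul R Am Bm) i k ≈⟨ +-cong (fsum-fidʳ k (Mm i)) (-‿cong MAB≈B) ⟩
          Mm i k - Bm i k                                                ∎
        bound : I (m +ℕ m ∸ toℕ i ∸ toℕ k) (fmul R Mm (fmul R G Bm) i k)
        bound = fsum-I {m} _ λ l →
          I-*-≤ (∸∸-lipschitzˡ (m +ℕ m) (toℕ i) (toℕ l) (toℕ k)) (M-banded (toℕ i) (toℕ l))
            (fsum-I {m} _ λ l′ →
              I-*-≤ (∸∸-lipschitzʳ (m +ℕ m) (toℕ l) (toℕ l′) (toℕ k))
                    (I-sub-sym (A-N (toℕ<n l) (toℕ<n l′))) (N⁻¹.banded m (toℕ l′) (toℕ k)))

      N-blockInverse≈M : ∀ m B′ → IsFInverse R (trunc R N m) B′ → ∀ (i k : Fin m) →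
        I (m +ℕ m ∸ toℕ i ∸ toℕ k) (trunc R M m i k - B′ i k)
      N-blockInverse≈M m B′ (_ , B′N≈1) i k =
        I-resp (+-congˡ (-‿cong (sym (FInverse-unique B′N≈1 (NB≈1 m) i k)))) (M-N-blockInverse m i k)

      M-blockInverse→N : ∀ {j k K m} (j<m : j < m) (k<m : k < m) → threshold j k K ≤ m →
        ∀ A′ → IsFInverse R (trunc R M m) A′ → I K (A′ (fromℕ< j<m) (fromℕ< k<m) - N j k)
      M-blockInverse→N {j} {k} {K} {m} j<m k<m h A′ A′-inverse = I-≤ (threshold-bound j k K h)
        (subst₂ (λ a b → I (m +ℕ m ∸ a ∸ b) (A′ (fromℕ< j<m) (fromℕ< k<m) - N a b))
                (toℕ-fromℕ< j<m) (toℕ-fromℕ< k<m) (M-blockInverse≈N m A′ A′-inverse (fromℕ< j<m) (fromℕ< k<m)))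

      N-blockInverse→M : ∀ {j k K m} (j<m : j < m) (k<m : k < m) → threshold j k K ≤ m →
        ∀ B′ → IsFInverse R (trunc R N m) B′ → I K (B′ (fromℕ< j<m) (fromℕ< k<m) - M j k)
      N-blockInverse→M {j} {k} {K} {m} j<m k<m h B′ B′-inverse = I-sub-sym (I-≤ (threshold-bound j k K h)
        (subst₂ (λ a b → I (m +ℕ m ∸ a ∸ b) (M a b - B′ (fromℕ< j<m) (fromℕ< k<m)))
                (toℕ-fromℕ< j<m) (toℕ-fromℕ< k<m) (N-blockInverse≈M m B′ B′-inverse (fromℕ< j<m) (fromℕ< k<m))))

open import Data.Nat using (_+_)

lemma2p1 : ∀ {c ℓ ℓ' : Level} (R : Ring c ℓ) (Fl : Filtration R ℓ') →
  Complete R Fl →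
  (M : Mat R Fl) →
  (∀ j k → Filtration.I Fl ∣ j - k ∣ (M j k)) →
  (∀ j → IsUnit R (M j j)) →
  let open Ring R using (_-_)
      open Filtration Fl using (I)
  in Σ (Mat R Fl) λ N →
       IsInverse R Fl M N
     × (∀ j k → I ∣ j - k ∣ (N j k))
     × (∀ m →
          Σ (FMat R m) (λ A → IsFInverse R (trunc R M m) A)
        × Σ (FMat R m) (λ B → IsFInverse R (trunc R N m) B)
        × (∀ A → IsFInverse R (trunc R M m) A → ∀ (i k : Fin m) →
             I ((m + m) ∸ toℕ i ∸ toℕ k) (A i k - trunc R N m i k))
        × (∀ B → IsFInverse R (trunc R N m) B → ∀ (i k : Fin m) →
             I ((m + m) ∸ toℕ i ∸ toℕ k) (trunc R M m i k - B i k)))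
     × (∀ j k K → Σ ℕ λ m₀ → ∀ m (j<m : j < m) (k<m : k < m) → m₀ ≤ m →
          (∀ A → IsFInverse R (trunc R M m) A →
             I K (A (fromℕ< j<m) (fromℕ< k<m) - N j k))
        × (∀ B → IsFInverse R (trunc R N m) B →
             I K (B (fromℕ< j<m) (fromℕ< k<m) - M j k)))
lemma2p1 R Fl complete M M-banded M-unitDiagonal =
  N , (MN≈δ , NM≈δ) , N-banded
    , (λ m → M-blockInverse m , N-blockInverse m , M-blockInverse≈N m , N-blockInverse≈M m)
    , λ j k K → threshold j k K , λ m j<m k<m m≥ →
        M-blockInverse→N j<m k<m m≥ , N-blockInverse→M j<m k<m m≥
  where open InverseLimit R Fl complete M M-banded M-unitDiagonal
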